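{- Let $k$ be an odd positive integer and $h$ a non-negative integer less than $k$ such that there is no residue class $\ell \pmod k$ with $(2\ell+1)^2\equiv 1+8h\pmod k$. Then $c_{k}^{(3)}(kn+h)=0$ for all integers $n\ge0$.
   Context: For an integer $k>1$, the cubic Borwein coefficients $c_k^{(3)}(n)$ are defined by $\frac{(q;q)_\infty^3}{(q^k;q^k)_\infty^3}=\sum_{n\ge0}c_k^{(3)}(n)q^n$, where $(a;q)_\infty=\prod_{j\ge0}(1-aq^j)$. -}

module Defs where

open import Data.Nat using (ℕ; zero; suc; _∸_) renaming (_*_ to _*ℕ_; _+_ to _+ℕ_)
open import Data.Nat.Divisibility using (_∣?_)
open import Data.Integer using (ℤ; +_; _+_; _*_; -_; 0ℤ; 1ℤ)
open import Relation.Nullary using (yes; no)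
open import Data.Bool using (if_then_else_)
open import Relation.Binary.PropositionalEquality using (_≡_)

-- Formal power series in q with integer coefficients: n ↦ coefficient of q^n.
Series : Set
Series = ℕ → ℤ

sumTo : ℕ → (ℕ → ℤ) → ℤ
sumTo zero    f = f 0
sumTo (suc n) f = sumTo n f + f (suc n)

_⊗_ : Series → Series → Series
(f ⊗ g) n = sumTo n (λ i → f i * g (n ∸ i))

one : Series
one zero    = 1ℤ
one (suc _) = 0ℤ

-- the polynomial 1 - q^m   (m ≥ 1)
oneMinusQ^ : ℕ → Series
oneMinusQ^ m n with n Data.Nat.≟ 0 | n Data.Nat.≟ m
... | yes _ | _     = 1ℤ
... | no _  | yes _ = - 1ℤ
... | no _  | no _  = 0ℤ

-- the series 1/(1 - q^m) = Σ_{t≥0} q^{m t}   (m ≥ 1)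
geom : ℕ → Series
geom m n with m ∣? n
... | yes _ = 1ℤ
... | no _  = 0ℤ

cube : Series → Series
cube f = f ⊗ (f ⊗ f)

partialProd : ℕ → ℕ → Series
partialProd k zero    = one
partialProd k (suc N) =
  partialProd k N ⊗ (cube (oneMinusQ^ (suc N)) ⊗ cube (geom (k *ℕ suc N)))

-- Cubic Borwein coefficient c_k^{(3)}(n): coefficient of q^n in
-- (q;q)_∞^3 / (q^k;q^k)_∞^3.  Factors with j > n are ≡ 1 mod q^{n+1},
-- so the coefficient of q^n equals that of the partial product up to j = n.
c3 : ℕ → ℕ → ℤ
c3 k n = partialProd k n n

-- Since ∏ⱼ (1 - q^(kj))⁻³ only involves powers of q^k, c₃ₖ(kn + h) is a combination of the coefficients of qⁱ
-- in (q;q)∞³ with i ≡ h (mod k), and up to degree i, (q;q)∞³ agrees with (q;q)ᵢ³. By Jacobi's identity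
-- (q;q)∞³ = ∑ⱼ (-1)ʲ (2j+1) q^(j(j+1)/2) such a coefficient vanishes unless i = j(j+1)/2, and then
-- (2j+1)² = 8i + 1 ≡ 1 + 8h (mod k), which the hypothesis excludes.
--
-- The coefficient form of Jacobi's identity comes from a finite one. Take the ε-part (ε² = 0) of the
-- q-binomial theorem ∏_{i<N} (y + x qⁱ) = ∑ₖ [N k] q^(k(k-1)/2) xᵏ y^(N-k) at N = 2n+1, x = -1, y = qⁿ(1 + ε).
-- Only the factor i = n vanishes at ε = 0, so the left side becomes ± q^e (q;q)ₙ², while on the right, after
-- multiplying by (q;q)ₙ, the k-th term is a constant times q^(e + j(j+1)/2) [N k] (q;q)ₙ, and [N k] (q;q)ₙ ≡ 1
-- to just the order that the coefficient of q^(e+n) sees.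

module Submission where

open import Defs
open import Algebra using (CommutativeSemiring; CommutativeRing)
open import Data.Nat as ℕ using (ℕ; zero; suc; _∸_; z≤n; s≤s)
import Data.Nat.Properties as ℕ
open import Data.Product using (_×_; _,_; proj₁; proj₂; ∃)
import Relation.Binary.PropositionalEquality as ≡
open ≡ using (_≡_; _≢_; _≗_)

C₂ : ℕ → ℕ
C₂ zero    = 0
C₂ (suc k) = k ℕ.+ C₂ k

module FiniteSums {c ℓ} (S : CommutativeSemiring c ℓ) where

  open CommutativeSemiring S
  open import Algebra.Properties.CommutativeSemiring.Exp S using (_^_; ^-homo-*)
  open import Algebra.Properties.CommutativeSemigroup +-commutativeSemigroup using (interchange)
  open import Relation.Binary.Reasoning.Setoid setoid

  ∑≤ : ℕ → (ℕ → Carrier) → Carrier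
  ∑≤ zero    f = f 0
  ∑≤ (suc n) f = ∑≤ n f + f (suc n)

  ∏< : ℕ → (ℕ → Carrier) → Carrier
  ∏< zero    f = 1#
  ∏< (suc n) f = ∏< n f * f n

  ∑≤-cong : ∀ n {f g : ℕ → Carrier} → (∀ i → i ℕ.≤ n → f i ≈ g i) → ∑≤ n f ≈ ∑≤ n g
  ∑≤-cong zero    f≈g = f≈g 0 z≤n
  ∑≤-cong (suc n) f≈g = +-cong (∑≤-cong n (λ i i≤n → f≈g i (ℕ.m≤n⇒m≤1+n i≤n))) (f≈g (suc n) ℕ.≤-refl)

  ∑≤-zero : ∀ n {f : ℕ → Carrier} → (∀ i → i ℕ.≤ n → f i ≈ 0#) → ∑≤ n f ≈ 0#
  ∑≤-zero zero    f≈0 = f≈0 0 z≤n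
  ∑≤-zero (suc n) f≈0 =
    trans (+-cong (∑≤-zero n (λ i i≤n → f≈0 i (ℕ.m≤n⇒m≤1+n i≤n))) (f≈0 (suc n) ℕ.≤-refl)) (+-identityˡ 0#)

  ∑≤-unfoldˡ : ∀ n (f : ℕ → Carrier) → ∑≤ (suc n) f ≈ f 0 + ∑≤ n (λ i → f (suc i))
  ∑≤-unfoldˡ zero    f = refl
  ∑≤-unfoldˡ (suc n) f = trans (+-congʳ (∑≤-unfoldˡ n f)) (+-assoc _ _ _)

  ∑≤-distrib-+ : ∀ n (f g : ℕ → Carrier) → ∑≤ n (λ i → f i + g i) ≈ ∑≤ n f + ∑≤ n g
  ∑≤-distrib-+ zero    f g = refl
  ∑≤-distrib-+ (suc n) f g = trans (+-congʳ (∑≤-distrib-+ n f g)) (interchange _ _ _ _)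

  *-distribˡ-∑≤ : ∀ n x (f : ℕ → Carrier) → x * ∑≤ n f ≈ ∑≤ n (λ i → x * f i)
  *-distribˡ-∑≤ zero    x f = refl
  *-distribˡ-∑≤ (suc n) x f = trans (distribˡ _ _ _) (+-congʳ (*-distribˡ-∑≤ n x f))

  *-distribʳ-∑≤ : ∀ n x (f : ℕ → Carrier) → ∑≤ n f * x ≈ ∑≤ n (λ i → f i * x)
  *-distribʳ-∑≤ zero    x f = refl
  *-distribʳ-∑≤ (suc n) x f = trans (distribʳ _ _ _) (+-congʳ (*-distribʳ-∑≤ n x f))

  ∑≤-reverse : ∀ n (f : ℕ → Carrier) → ∑≤ n f ≈ ∑≤ n (λ i → f (n ∸ i))
  ∑≤-reverse zero    f = refl
  ∑≤-reverse (suc n) f = begin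
    ∑≤ n f + f (suc n)                  ≈⟨ +-comm _ _ ⟩
    f (suc n) + ∑≤ n f                  ≈⟨ +-congˡ (∑≤-reverse n f) ⟩
    f (suc n) + ∑≤ n (λ i → f (n ∸ i))  ≈⟨ ∑≤-unfoldˡ n (λ i → f (suc n ∸ i)) ⟨
    ∑≤ (suc n) (λ i → f (suc n ∸ i))    ∎

  ∑≤-triangle : ∀ n (F : ℕ → ℕ → Carrier) →
    ∑≤ n (λ i → ∑≤ i (λ a → F a i)) ≈ ∑≤ n (λ a → ∑≤ (n ∸ a) (λ b → F a (a ℕ.+ b)))
  ∑≤-triangle zero    F = refl
  ∑≤-triangle (suc n) F = begin
    ∑≤ n (λ i → ∑≤ i (λ a → F a i)) + (∑≤ n (λ a → F a (suc n)) + F (suc n) (suc n))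
      ≈⟨ +-congʳ (∑≤-triangle n F) ⟩
    rows n + (∑≤ n (λ a → F a (suc n)) + F (suc n) (suc n))
      ≈⟨ +-assoc _ _ _ ⟨
    (rows n + ∑≤ n (λ a → F a (suc n))) + F (suc n) (suc n)
      ≈⟨ +-congʳ (∑≤-distrib-+ n _ _) ⟨
    ∑≤ n (λ a → ∑≤ (n ∸ a) (λ b → F a (a ℕ.+ b)) + F a (suc n)) + F (suc n) (suc n)
      ≈⟨ +-cong (∑≤-cong n extendRow) (reflexive (≡.cong (F (suc n)) (ℕ.+-identityʳ (suc n)))) ⟨
    ∑≤ n (λ a → ∑≤ (suc n ∸ a) (λ b → F a (a ℕ.+ b))) + F (suc n) (suc n ℕ.+ 0)
      ≡⟨ ≡.cong (λ m → ∑≤ n (λ a → ∑≤ (suc n ∸ a) (λ b → F a (a ℕ.+ b))) + ∑≤ m (λ b → F (suc n) (suc n ℕ.+ b)))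
                (ℕ.n∸n≡0 n) ⟨
    ∑≤ (suc n) (λ a → ∑≤ (suc n ∸ a) (λ b → F a (a ℕ.+ b))) ∎
    where
    rows : ℕ → Carrier
    rows m = ∑≤ m (λ a → ∑≤ (m ∸ a) (λ b → F a (a ℕ.+ b)))
    extendRow : ∀ a → a ℕ.≤ n →
      ∑≤ (suc n ∸ a) (λ b → F a (a ℕ.+ b)) ≈ ∑≤ (n ∸ a) (λ b → F a (a ℕ.+ b)) + F a (suc n)
    extendRow a a≤n rewrite ℕ.+-∸-assoc 1 a≤n =
      +-congˡ (reflexive (≡.cong (F a) (≡.trans (ℕ.+-suc a (n ∸ a)) (≡.cong suc (ℕ.m+[n∸m]≡n a≤n)))))

  ∏<-cong : ∀ n {f g : ℕ → Carrier} → (∀ i → i ℕ.< n → f i ≈ g i) → ∏< n f ≈ ∏< n g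
  ∏<-cong zero    f≈g = refl
  ∏<-cong (suc n) f≈g = *-cong (∏<-cong n (λ i i<n → f≈g i (ℕ.m≤n⇒m≤1+n i<n))) (f≈g n ℕ.≤-refl)

  ∏<-unfoldˡ : ∀ n (f : ℕ → Carrier) → ∏< (suc n) f ≈ f 0 * ∏< n (λ i → f (suc i))
  ∏<-unfoldˡ zero    f = trans (*-identityˡ _) (sym (*-identityʳ _))
  ∏<-unfoldˡ (suc n) f = trans (*-congʳ (∏<-unfoldˡ n f)) (*-assoc _ _ _)

  ∏<-distrib-* : ∀ n (f g : ℕ → Carrier) → ∏< n (λ i → f i * g i) ≈ ∏< n f * ∏< n g
  ∏<-distrib-* zero    f g = sym (*-identityˡ 1#)
  ∏<-distrib-* (suc n) f g = trans (*-congʳ (∏<-distrib-* n f g)) (*-interchange _ _ _ _)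
    where open import Algebra.Properties.CommutativeSemigroup *-commutativeSemigroup
            renaming (interchange to *-interchange)

  ∏<-split : ∀ a b (f : ℕ → Carrier) → ∏< (a ℕ.+ b) f ≈ ∏< a f * ∏< b (λ i → f (a ℕ.+ i))
  ∏<-split a zero    f rewrite ℕ.+-identityʳ a = sym (*-identityʳ _)
  ∏<-split a (suc b) f rewrite ℕ.+-suc a b = trans (*-congʳ (∏<-split a b f)) (*-assoc _ _ _)

  ∏<-const : ∀ n x → ∏< n (λ _ → x) ≈ x ^ n
  ∏<-const zero    x = refl
  ∏<-const (suc n) x = trans (*-congʳ (∏<-const n x)) (*-comm _ _)

  ∏<-^ : ∀ n x → ∏< n (λ i → x ^ i) ≈ x ^ C₂ n
  ∏<-^ zero    x = refl
  ∏<-^ (suc n) x = trans (*-congʳ (∏<-^ n x)) (trans (*-comm _ _) (sym (^-homo-* x n (C₂ n))))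

module QBinomial {c ℓ} (S : CommutativeSemiring c ℓ) (q : CommutativeSemiring.Carrier S) where

  open CommutativeSemiring S
  open import Algebra.Properties.CommutativeSemiring.Exp S
  open import Algebra.Solver.Ring.NaturalCoefficients.Default S
  open import Relation.Binary.Reasoning.Setoid setoid
  open FiniteSums S

  qBinomial : ℕ → ℕ → Carrier
  qBinomial _       zero    = 1#
  qBinomial zero    (suc k) = 0#
  qBinomial (suc N) (suc k) = qBinomial N k + q ^ suc k * qBinomial N (suc k)

  qBinomial-vanishes : ∀ N k → N ℕ.< k → qBinomial N k ≈ 0#
  qBinomial-vanishes zero    (suc k) _         = refl
  qBinomial-vanishes (suc N) (suc k) (s≤s N<k) = begin
    qBinomial N k + q ^ suc k * qBinomial N (suc k)
      ≈⟨ +-cong (qBinomial-vanishes N k N<k) (*-congˡ (qBinomial-vanishes N (suc k) (ℕ.m≤n⇒m≤1+n N<k))) ⟩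
    0# + q ^ suc k * 0#  ≈⟨ trans (+-identityˡ _) (zeroʳ _) ⟩
    0#                   ∎

  rotheTerm : ℕ → Carrier → Carrier → ℕ → Carrier
  rotheTerm N x y k = qBinomial N k * q ^ C₂ k * x ^ k * y ^ (N ∸ k)

  -- The q-Pascal rule makes the terms of y·(…) and x·(…) interleave into the next row.
  rothe-step : ∀ N x y →
    (y + x) * ∑≤ N (rotheTerm N (x * q) y) ≈ ∑≤ (suc N) (rotheTerm (suc N) x y)
  rothe-step N x y = begin
    (y + x) * ∑≤ N A                                ≈⟨ distribʳ _ _ _ ⟩
    y * ∑≤ N A + x * ∑≤ N A                         ≈⟨ +-cong (*-distribˡ-∑≤ N y A) (*-distribˡ-∑≤ N x A) ⟩
    ∑≤ N (λ k → y * A k) + ∑≤ N (λ k → x * A k)     ≈⟨ +-cong (∑≤-cong N yA≈down) (∑≤-cong N (λ k _ → xA≈up k)) ⟩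
    ∑≤ N down + ∑≤ N up                             ≈⟨ +-congʳ (trans (sym (+-identityʳ _)) (+-congˡ (sym down-top))) ⟩
    ∑≤ (suc N) down + ∑≤ N up                       ≈⟨ +-congʳ (∑≤-unfoldˡ N down) ⟩
    (down 0 + ∑≤ N (λ k → down (suc k))) + ∑≤ N up  ≈⟨ +-assoc _ _ _ ⟩
    down 0 + (∑≤ N (λ k → down (suc k)) + ∑≤ N up)  ≈⟨ +-congˡ (sym (∑≤-distrib-+ N _ _)) ⟩
    down 0 + ∑≤ N (λ k → down (suc k) + up k)       ≈⟨ +-cong down-0 (∑≤-cong N (λ k _ → pascal k)) ⟩
    B 0 + ∑≤ N (λ k → B (suc k))                    ≈⟨ ∑≤-unfoldˡ N B ⟨
    ∑≤ (suc N) B                                    ∎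
    where
    A B down up : ℕ → Carrier
    A = rotheTerm N (x * q) y
    B = rotheTerm (suc N) x y
    down k = qBinomial N k * q ^ C₂ k * x ^ k * q ^ k * y ^ (suc N ∸ k)
    up   k = qBinomial N k * q ^ C₂ (suc k) * x ^ suc k * y ^ (N ∸ k)

    yA≈down : ∀ k → k ℕ.≤ N → y * A k ≈ down k
    yA≈down k k≤N rewrite ℕ.+-∸-assoc 1 k≤N =
      trans (*-congˡ (*-congʳ (*-congˡ (^-distrib-* x q k))))
        (solve 6 (λ y a b c d e → y :* (a :* b :* (c :* d) :* e) := a :* b :* c :* d :* (y :* e))
           refl y _ _ _ _ _)

    xA≈up : ∀ k → x * A k ≈ up k
    xA≈up k = begin
      x * (qBinomial N k * q ^ C₂ k * (x * q) ^ k * y ^ (N ∸ k))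
        ≈⟨ *-congˡ (*-congʳ (*-congˡ (^-distrib-* x q k))) ⟩
      x * (qBinomial N k * q ^ C₂ k * (x ^ k * q ^ k) * y ^ (N ∸ k))
        ≈⟨ solve 6 (λ x a b c d e → x :* (a :* b :* (c :* d) :* e) := a :* (d :* b) :* (x :* c) :* e)
             refl x _ _ _ _ _ ⟩
      qBinomial N k * (q ^ k * q ^ C₂ k) * x ^ suc k * y ^ (N ∸ k)
        ≈⟨ *-congʳ (*-congʳ (*-congˡ (sym (^-homo-* q k (C₂ k))))) ⟩
      up k ∎

    down-top : down (suc N) ≈ 0#
    down-top = begin
      qBinomial N (suc N) * q ^ C₂ (suc N) * x ^ suc N * q ^ suc N * y ^ (N ∸ N)
        ≈⟨ *-congʳ (*-congʳ (*-congʳ (*-congʳ (qBinomial-vanishes N (suc N) ℕ.≤-refl)))) ⟩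
      0# * q ^ C₂ (suc N) * x ^ suc N * q ^ suc N * y ^ (N ∸ N)
        ≈⟨ solve 4 (λ a b c d → con 0 :* a :* b :* c :* d := con 0) refl _ _ _ _ ⟩
      0# ∎

    down-0 : down 0 ≈ B 0
    down-0 = *-congʳ (solve 1 (λ a → a :* con 1 :* con 1 :* con 1 := a :* con 1 :* con 1) refl _)

    pascal : ∀ k → down (suc k) + up k ≈ B (suc k)
    pascal k = solve 6 (λ a b c e d a′ → a′ :* b :* c :* d :* e :+ a :* b :* c :* e := (a :+ d :* a′) :* b :* c :* e)
      refl (qBinomial N k) (q ^ C₂ (suc k)) (x ^ suc k) (y ^ (N ∸ k)) (q ^ suc k) (qBinomial N (suc k))

  rothe : ∀ N x y → ∏< N (λ i → y + x * q ^ i) ≈ ∑≤ N (rotheTerm N x y)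
  rothe zero    x y = solve 0 (con 1 := con 1 :* con 1 :* con 1 :* con 1) refl
  rothe (suc N) x y = begin
    ∏< (suc N) (λ i → y + x * q ^ i)
      ≈⟨ ∏<-unfoldˡ N _ ⟩
    (y + x * 1#) * ∏< N (λ i → y + x * (q * q ^ i))
      ≈⟨ *-cong (+-congˡ (*-identityʳ x)) (∏<-cong N (λ i _ → +-congˡ (sym (*-assoc x q _)))) ⟩
    (y + x) * ∏< N (λ i → y + x * q * q ^ i)
      ≈⟨ *-congˡ (rothe N (x * q) y) ⟩
    (y + x) * ∑≤ N (rotheTerm N (x * q) y)
      ≈⟨ rothe-step N x y ⟩
    ∑≤ (suc N) (rotheTerm (suc N) x y) ∎

module DualNumbers {c ℓ} (S : CommutativeSemiring c ℓ) where

  open CommutativeSemiring S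
  open import Algebra.Properties.CommutativeSemiring.Exp S
  open import Algebra.Properties.Semiring.Mult semiring using () renaming (_×_ to _×ₙ_)
  open import Algebra.Solver.Ring.NaturalCoefficients.Default S
  open import Relation.Binary.Structures using (IsEquivalence)
  open FiniteSums S

  Dual : Set c
  Dual = Carrier × Carrier

  infix  4 _≈ᴰ_
  infixl 6 _+ᴰ_
  infixl 7 _*ᴰ_

  _≈ᴰ_ : Dual → Dual → Set ℓ
  (a , b) ≈ᴰ (c , d) = (a ≈ c) × (b ≈ d)

  _+ᴰ_ : Dual → Dual → Dual
  (a , b) +ᴰ (c , d) = (a + c , b + d)

  _*ᴰ_ : Dual → Dual → Dual
  (a , b) *ᴰ (c , d) = (a * c , a * d + b * c)

  private
    ≈ᴰ-isEquivalence : IsEquivalence _≈ᴰ_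
    ≈ᴰ-isEquivalence = record
      { refl  = refl , refl
      ; sym   = λ (p , q) → sym p , sym q
      ; trans = λ (p , q) (r , s) → trans p r , trans q s
      }

  dualSemiring : CommutativeSemiring c ℓ
  dualSemiring = record
    { Carrier = Dual ; _≈_ = _≈ᴰ_ ; _+_ = _+ᴰ_ ; _*_ = _*ᴰ_ ; 0# = (0# , 0#) ; 1# = (1# , 0#)
    ; isCommutativeSemiring = record
      { isSemiring = record
        { isSemiringWithoutAnnihilatingZero = record
          { +-isCommutativeMonoid = record
            { isMonoid = record
              { isSemigroup = record
                { isMagma = record
                  { isEquivalence = ≈ᴰ-isEquivalence
                  ; ∙-cong = λ (p , q) (r , s) → +-cong p r , +-cong q s }
                ; assoc = λ _ _ _ → +-assoc _ _ _ , +-assoc _ _ _ }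
              ; identity = (λ _ → +-identityˡ _ , +-identityˡ _) , (λ _ → +-identityʳ _ , +-identityʳ _) }
            ; comm = λ _ _ → +-comm _ _ , +-comm _ _ }
          ; *-cong = λ (p , q) (r , s) → *-cong p r , +-cong (*-cong p s) (*-cong q r)
          ; *-assoc = λ (a , b) (c , d) (e , f) → *-assoc _ _ _ ,
              solve 6 (λ a b c d e f → (a :* c) :* f :+ (a :* d :+ b :* c) :* e
                                    := a :* (c :* f :+ d :* e) :+ b :* (c :* e)) refl a b c d e f
          ; *-identity = (λ (a , b) → *-identityˡ _ , solve 2 (λ a b → con 1 :* b :+ con 0 :* a := b) refl a b)
                       , (λ (a , b) → *-identityʳ _ , solve 2 (λ a b → a :* con 0 :+ b :* con 1 := b) refl a b)
          ; distrib = (λ (a , b) (c , d) (e , f) → distribˡ _ _ _ ,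
                         solve 6 (λ a b c d e f → a :* (d :+ f) :+ b :* (c :+ e)
                                               := (a :* d :+ b :* c) :+ (a :* f :+ b :* e)) refl a b c d e f)
                    , (λ (a , b) (c , d) (e , f) → distribʳ _ _ _ ,
                         solve 6 (λ a b c d e f → (c :+ e) :* b :+ (d :+ f) :* a
                                               := (c :* b :+ d :* a) :+ (e :* b :+ f :* a)) refl a b c d e f) }
        ; zero = (λ (a , b) → zeroˡ _ , solve 2 (λ a b → con 0 :* b :+ con 0 :* a := con 0) refl a b)
               , (λ (a , b) → zeroʳ _ , solve 2 (λ a b → a :* con 0 :+ b :* con 0 := con 0) refl a b) }
      ; *-comm = λ (a , b) (c , d) → *-comm _ _ , solve 4 (λ a b c d → a :* d :+ b :* c := c :* b :+ d :* a) refl a b c d } }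

  module 𝔻 = CommutativeSemiring dualSemiring
  open import Algebra.Properties.CommutativeSemiring.Exp dualSemiring renaming (_^_ to _^ᴰ_)
  module ∑ᴰ = FiniteSums dualSemiring

  ι : Carrier → Dual
  ι a = (a , 0#)

  ι-+ : ∀ a b → ι a +ᴰ ι b ≈ᴰ ι (a + b)
  ι-+ a b = refl , +-identityʳ 0#

  ι-* : ∀ a b → ι a *ᴰ ι b ≈ᴰ ι (a * b)
  ι-* a b = refl , trans (+-cong (zeroʳ a) (zeroˡ b)) (+-identityʳ 0#)

  ι-^ : ∀ a n → ι a ^ᴰ n ≈ᴰ ι (a ^ n)
  ι-^ a zero    = 𝔻.refl
  ι-^ a (suc n) = 𝔻.trans (𝔻.*-congˡ (ι-^ a n)) (ι-* a (a ^ n))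

  [1+ε]-^ : ∀ a m → (a , a) ^ᴰ m ≈ᴰ (a ^ m , a ^ m * (m ×ₙ 1#))
  [1+ε]-^ a zero    = refl , sym (zeroʳ 1#)
  [1+ε]-^ a (suc m) = 𝔻.trans (𝔻.*-congˡ {a , a} ([1+ε]-^ a m))
    (refl , solve 3 (λ a p s → a :* (p :* s) :+ a :* p := (a :* p) :* (con 1 :+ s)) refl a (a ^ m) (m ×ₙ 1#))

  proj₂-ι-*ᴰ : ∀ c d → proj₂ (ι c *ᴰ d) ≈ c * proj₂ d
  proj₂-ι-*ᴰ c (u , v) = trans (+-congˡ (zeroˡ u)) (+-identityʳ _)

  proj₂-*ᴰ-nilpotent : ∀ x z y → proj₁ z ≈ 0# → proj₂ (x *ᴰ (z *ᴰ y)) ≈ proj₁ x * (proj₂ z * proj₁ y)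
  proj₂-*ᴰ-nilpotent (a , b) (c , d) (e , f) c≈0 = trans
    (+-cong (*-congˡ (+-congʳ (*-congʳ c≈0))) (*-congˡ (*-congʳ c≈0)))
    (solve 5 (λ a b d e f → a :* (con 0 :* f :+ d :* e) :+ b :* (con 0 :* e) := a :* (d :* e)) refl a b d e f)

  proj₁-∏< : ∀ n (f : ℕ → Dual) → proj₁ (∑ᴰ.∏< n f) ≈ ∏< n (λ i → proj₁ (f i))
  proj₁-∏< zero    f = refl
  proj₁-∏< (suc n) f = *-congʳ (proj₁-∏< n f)

  proj₂-∑≤ : ∀ n (f : ℕ → Dual) → proj₂ (∑ᴰ.∑≤ n f) ≈ ∑≤ n (λ i → proj₂ (f i))
  proj₂-∑≤ zero    f = refl
  proj₂-∑≤ (suc n) f = +-congʳ (proj₂-∑≤ n f)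

  module _ (q : Carrier) where
    open QBinomial S q
    private module QBᴰ = QBinomial dualSemiring (ι q)

    qBinomial-ι : ∀ N k → QBᴰ.qBinomial N k ≈ᴰ ι (qBinomial N k)
    qBinomial-ι _       zero    = 𝔻.refl
    qBinomial-ι zero    (suc k) = 𝔻.refl
    qBinomial-ι (suc N) (suc k) = 𝔻.trans
      (𝔻.+-cong (qBinomial-ι N k) (𝔻.trans (𝔻.*-cong (ι-^ q (suc k)) (qBinomial-ι N (suc k))) (ι-* _ _)))
      (ι-+ _ _)

module QPochhammer {c ℓ} (R : CommutativeRing c ℓ) (q : CommutativeRing.Carrier R) where

  open CommutativeRing R
  open import Algebra.Properties.CommutativeSemiring.Exp commutativeSemiring
  open import Data.Sum using (_⊎_; inj₁; inj₂)
  open import Algebra.Properties.Ring ring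
    using (-‿distribʳ-*; -‿distribˡ-*; -1*x≈-x; -‿anti-homo-+; -‿involutive; x[y-z]≈xy-xz)
  open import Algebra.Solver.Ring.NaturalCoefficients.Default commutativeSemiring
  open import Relation.Binary.Reasoning.Setoid setoid
  open FiniteSums commutativeSemiring
  open QBinomial commutativeSemiring q

  1-q^ : ℕ → Carrier
  1-q^ i = 1# - q ^ i

  poch : ℕ → Carrier
  poch k = ∏< k (λ i → 1-q^ (suc i))

  topPoch : ℕ → ℕ → Carrier
  topPoch N k = ∏< k (λ i → 1-q^ (N ∸ i))

  1-q^-+ : ∀ a b → 1-q^ a + q ^ a * 1-q^ b ≈ 1-q^ (a ℕ.+ b)
  1-q^-+ a b = begin
    (1# - A) + A * (1# - B)  ≈⟨ +-congˡ (trans (distribˡ _ _ _) (+-cong (*-identityʳ _) (sym (-‿distribʳ-* _ _)))) ⟩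
    (1# - A) + (A - A * B)   ≈⟨ solve 4 (λ o nA a nAB → (o :+ nA) :+ (a :+ nAB) := o :+ (nA :+ a) :+ nAB) refl 1# (- A) A (- (A * B)) ⟩
    1# + (- A + A) - A * B   ≈⟨ +-cong (trans (+-congˡ (-‿inverseˡ A)) (+-identityʳ _)) (-‿cong (sym (^-homo-* q a b))) ⟩
    1# - q ^ (a ℕ.+ b)       ∎
    where
    A B : Carrier
    A = q ^ a
    B = q ^ b

  qBinomial-poch : ∀ N k → k ℕ.≤ N → qBinomial N k * poch k ≈ topPoch N k
  qBinomial-poch N       zero    _         = *-identityʳ 1#
  qBinomial-poch (suc N) (suc k) (s≤s k≤N) = begin
    (qBinomial N k + q ^ suc k * qBinomial N (suc k)) * (poch k * 1-q^ (suc k))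
      ≈⟨ solve 5 (λ a b c d e → (a :+ b :* c) :* (d :* e) := a :* d :* e :+ b :* (c :* (d :* e))) refl _ _ _ _ _ ⟩
    qBinomial N k * poch k * 1-q^ (suc k) + q ^ suc k * (qBinomial N (suc k) * poch (suc k))
      ≈⟨ +-congʳ (*-congʳ (qBinomial-poch N k k≤N)) ⟩
    topPoch N k * 1-q^ (suc k) + q ^ suc k * (qBinomial N (suc k) * poch (suc k))
      ≈⟨ lastFactor (ℕ.m≤n⇒m<n∨m≡n k≤N) ⟩
    topPoch N k * 1-q^ (suc N)
      ≈⟨ *-comm _ _ ⟩
    1-q^ (suc N) * topPoch N k
      ≈⟨ ∏<-unfoldˡ k (λ i → 1-q^ (suc N ∸ i)) ⟨
    topPoch (suc N) (suc k) ∎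
    where
    lastFactor : k ℕ.< N ⊎ k ≡ N →
      topPoch N k * 1-q^ (suc k) + q ^ suc k * (qBinomial N (suc k) * poch (suc k)) ≈ topPoch N k * 1-q^ (suc N)
    lastFactor (inj₁ k<N) = begin
      topPoch N k * 1-q^ (suc k) + q ^ suc k * (qBinomial N (suc k) * poch (suc k))
        ≈⟨ +-congˡ (*-congˡ (qBinomial-poch N (suc k) k<N)) ⟩
      topPoch N k * 1-q^ (suc k) + q ^ suc k * (topPoch N k * 1-q^ (N ∸ k))
        ≈⟨ solve 4 (λ r e p f → r :* e :+ p :* (r :* f) := r :* (e :+ p :* f)) refl _ _ _ _ ⟩
      topPoch N k * (1-q^ (suc k) + q ^ suc k * 1-q^ (N ∸ k))
        ≈⟨ *-congˡ (1-q^-+ (suc k) (N ∸ k)) ⟩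
      topPoch N k * 1-q^ (suc k ℕ.+ (N ∸ k))
        ≡⟨ ≡.cong (λ m → topPoch N k * 1-q^ (suc m)) (ℕ.m+[n∸m]≡n k≤N) ⟩
      topPoch N k * 1-q^ (suc N) ∎
    lastFactor (inj₂ ≡.refl) = begin
      topPoch k k * 1-q^ (suc k) + q ^ suc k * (qBinomial k (suc k) * poch (suc k))
        ≈⟨ +-congˡ (*-congˡ (*-congʳ (qBinomial-vanishes k (suc k) ℕ.≤-refl))) ⟩
      topPoch k k * 1-q^ (suc k) + q ^ suc k * (0# * poch (suc k))
        ≈⟨ trans (+-congˡ (trans (*-congˡ (zeroˡ _)) (zeroʳ _))) (+-identityʳ _) ⟩
      topPoch k k * 1-q^ (suc k) ∎

  topPoch-diagonal : ∀ n → topPoch n n ≈ poch n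
  topPoch-diagonal zero    = refl
  topPoch-diagonal (suc n) =
    trans (∏<-unfoldˡ n (λ i → 1-q^ (suc n ∸ i))) (trans (*-congˡ (topPoch-diagonal n)) (*-comm _ _))

  q^-q^-below : ∀ n i → i ℕ.≤ n → q ^ n - q ^ i ≈ - 1# * q ^ i * 1-q^ (n ∸ i)
  q^-q^-below n i i≤n = sym (begin
    - 1# * q ^ i * (1# - q ^ (n ∸ i))     ≈⟨ *-congʳ (-1*x≈-x (q ^ i)) ⟩
    - q ^ i * (1# - q ^ (n ∸ i))          ≈⟨ -‿distribˡ-* _ _ ⟨
    - (q ^ i * (1# - q ^ (n ∸ i)))        ≈⟨ -‿cong (x[y-z]≈xy-xz _ _ _) ⟩
    - (q ^ i * 1# - q ^ i * q ^ (n ∸ i))  ≈⟨ -‿cong (+-cong (*-identityʳ _) (-‿cong (sym (^-homo-* q i (n ∸ i))))) ⟩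
    - (q ^ i - q ^ (i ℕ.+ (n ∸ i)))       ≡⟨ ≡.cong (λ m → - (q ^ i - q ^ m)) (ℕ.m+[n∸m]≡n i≤n) ⟩
    - (q ^ i - q ^ n)                     ≈⟨ -‿anti-homo-+ _ _ ⟩
    - - q ^ n - q ^ i                     ≈⟨ +-congʳ (-‿involutive _) ⟩
    q ^ n - q ^ i                         ∎)

  q^-q^-above : ∀ n m → q ^ n - q ^ (n ℕ.+ m) ≈ q ^ n * 1-q^ m
  q^-q^-above n m = sym (begin
    q ^ n * (1# - q ^ m)        ≈⟨ x[y-z]≈xy-xz _ _ _ ⟩
    q ^ n * 1# - q ^ n * q ^ m  ≈⟨ +-cong (*-identityʳ _) (-‿cong (sym (^-homo-* q n m))) ⟩
    q ^ n - q ^ (n ℕ.+ m)       ∎)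

  ∏<-q^-q^-below : ∀ n → ∏< n (λ i → q ^ n - q ^ i) ≈ (- 1#) ^ n * q ^ C₂ n * poch n
  ∏<-q^-q^-below n = begin
    ∏< n (λ i → q ^ n - q ^ i)                       ≈⟨ ∏<-cong n (λ i i<n → q^-q^-below n i (ℕ.<⇒≤ i<n)) ⟩
    ∏< n (λ i → - 1# * q ^ i * 1-q^ (n ∸ i))         ≈⟨ ∏<-distrib-* n _ _ ⟩
    ∏< n (λ i → - 1# * q ^ i) * topPoch n n          ≈⟨ *-cong (∏<-distrib-* n _ _) (topPoch-diagonal n) ⟩
    ∏< n (λ _ → - 1#) * ∏< n (λ i → q ^ i) * poch n  ≈⟨ *-congʳ (*-cong (∏<-const n (- 1#)) (∏<-^ n q)) ⟩
    (- 1#) ^ n * q ^ C₂ n * poch n                   ∎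

  ∏<-q^-q^-above : ∀ n → ∏< n (λ i → q ^ n - q ^ (n ℕ.+ suc i)) ≈ q ^ (n ℕ.* n) * poch n
  ∏<-q^-q^-above n = begin
    ∏< n (λ i → q ^ n - q ^ (n ℕ.+ suc i))  ≈⟨ ∏<-cong n (λ i _ → q^-q^-above n (suc i)) ⟩
    ∏< n (λ i → q ^ n * 1-q^ (suc i))       ≈⟨ ∏<-distrib-* n _ _ ⟩
    ∏< n (λ _ → q ^ n) * poch n             ≈⟨ *-congʳ (trans (∏<-const n (q ^ n)) (^-assocʳ q n n)) ⟩
    q ^ (n ℕ.* n) * poch n                  ∎

module PowerSeries where

  open import Data.Integer as ℤ using (ℤ; 0ℤ; 1ℤ) renaming (_+_ to _+ℤ_; _*_ to _*ℤ_; -_ to -ℤ_)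
  import Data.Integer.Properties as ℤ
  open import Algebra.Structures using (IsCommutativeRing)
  open import Level using (0ℓ)
  open ≡ using (refl; sym; trans; cong; cong₂)
  open import Relation.Binary.Definitions using (tri<; tri≈; tri>)
  open import Relation.Nullary using (yes; no; contradiction)
  open ≡.≡-Reasoning
  module ∑ℤ = FiniteSums ℤ.+-*-commutativeSemiring
  open ∑ℤ using (∑≤)

  sumTo≡∑≤ : ∀ n f → sumTo n f ≡ ∑≤ n f
  sumTo≡∑≤ zero    f = refl
  sumTo≡∑≤ (suc n) f = cong (_+ℤ f (suc n)) (sumTo≡∑≤ n f)

  sumTo-cong : ∀ n {f g : ℕ → ℤ} → (∀ i → i ℕ.≤ n → f i ≡ g i) → sumTo n f ≡ sumTo n g
  sumTo-cong n {f} {g} f≡g = trans (sumTo≡∑≤ n f) (trans (∑ℤ.∑≤-cong n f≡g) (sym (sumTo≡∑≤ n g)))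

  sumTo-zero : ∀ n {f : ℕ → ℤ} → (∀ i → i ℕ.≤ n → f i ≡ 0ℤ) → sumTo n f ≡ 0ℤ
  sumTo-zero n {f} f≡0 = trans (sumTo≡∑≤ n f) (∑ℤ.∑≤-zero n f≡0)

  ⊗-cong : ∀ {f f′ g g′} → f ≗ f′ → g ≗ g′ → f ⊗ g ≗ f′ ⊗ g′
  ⊗-cong f≗f′ g≗g′ n = sumTo-cong n (λ i _ → cong₂ _*ℤ_ (f≗f′ i) (g≗g′ (n ∸ i)))

  ⊗-comm : ∀ f g → f ⊗ g ≗ g ⊗ f
  ⊗-comm f g n = begin
    sumTo n (λ i → f i *ℤ g (n ∸ i))           ≡⟨ sumTo≡∑≤ n _ ⟩
    ∑≤ n (λ i → f i *ℤ g (n ∸ i))              ≡⟨ ∑ℤ.∑≤-reverse n _ ⟩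
    ∑≤ n (λ i → f (n ∸ i) *ℤ g (n ∸ (n ∸ i)))  ≡⟨ ∑ℤ.∑≤-cong n (λ i i≤n →
                                                     trans (cong (λ m → f (n ∸ i) *ℤ g m) (ℕ.m∸[m∸n]≡n i≤n))
                                                           (ℤ.*-comm (f (n ∸ i)) (g i))) ⟩
    ∑≤ n (λ i → g i *ℤ f (n ∸ i))              ≡⟨ sumTo≡∑≤ n _ ⟨
    sumTo n (λ i → g i *ℤ f (n ∸ i))           ∎

  ⊗-identityˡ : ∀ f → one ⊗ f ≗ f
  ⊗-identityˡ f zero    = ℤ.*-identityˡ (f 0)
  ⊗-identityˡ f (suc n) = begin
    sumTo (suc n) (λ i → one i *ℤ f (suc n ∸ i))     ≡⟨ sumTo≡∑≤ (suc n) _ ⟩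
    ∑≤ (suc n) (λ i → one i *ℤ f (suc n ∸ i))        ≡⟨ ∑ℤ.∑≤-unfoldˡ n _ ⟩
    1ℤ *ℤ f (suc n) +ℤ ∑≤ n (λ i → 0ℤ *ℤ f (n ∸ i))  ≡⟨ cong₂ _+ℤ_ (ℤ.*-identityˡ (f (suc n)))
                                                              (∑ℤ.∑≤-zero n (λ _ _ → refl)) ⟩
    f (suc n) +ℤ 0ℤ                                  ≡⟨ ℤ.+-identityʳ _ ⟩
    f (suc n)                                        ∎

  ⊗-distribˡ : ∀ f g h → f ⊗ (λ n → g n +ℤ h n) ≗ (λ n → (f ⊗ g) n +ℤ (f ⊗ h) n)
  ⊗-distribˡ f g h n = begin
    sumTo n (λ i → f i *ℤ (g (n ∸ i) +ℤ h (n ∸ i)))                 ≡⟨ sumTo≡∑≤ n _ ⟩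
    ∑≤ n (λ i → f i *ℤ (g (n ∸ i) +ℤ h (n ∸ i)))                    ≡⟨ ∑ℤ.∑≤-cong n (λ i _ → ℤ.*-distribˡ-+ (f i) _ _) ⟩
    ∑≤ n (λ i → f i *ℤ g (n ∸ i) +ℤ f i *ℤ h (n ∸ i))               ≡⟨ ∑ℤ.∑≤-distrib-+ n _ _ ⟩
    ∑≤ n (λ i → f i *ℤ g (n ∸ i)) +ℤ ∑≤ n (λ i → f i *ℤ h (n ∸ i))  ≡⟨ cong₂ _+ℤ_ (sumTo≡∑≤ n _) (sumTo≡∑≤ n _) ⟨
    (f ⊗ g) n +ℤ (f ⊗ h) n                                          ∎

  ⊗-assoc : ∀ f g h → (f ⊗ g) ⊗ h ≗ f ⊗ (g ⊗ h)
  ⊗-assoc f g h n = begin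
    sumTo n (λ i → (f ⊗ g) i *ℤ h (n ∸ i))
      ≡⟨ trans (sumTo≡∑≤ n _) (∑ℤ.∑≤-cong n (λ i _ → cong (_*ℤ h (n ∸ i)) (sumTo≡∑≤ i _))) ⟩
    ∑≤ n (λ i → ∑≤ i (λ a → f a *ℤ g (i ∸ a)) *ℤ h (n ∸ i))
      ≡⟨ ∑ℤ.∑≤-cong n (λ i _ → ∑ℤ.*-distribʳ-∑≤ i (h (n ∸ i)) _) ⟩
    ∑≤ n (λ i → ∑≤ i (λ a → f a *ℤ g (i ∸ a) *ℤ h (n ∸ i)))
      ≡⟨ ∑ℤ.∑≤-triangle n (λ a i → f a *ℤ g (i ∸ a) *ℤ h (n ∸ i)) ⟩
    ∑≤ n (λ a → ∑≤ (n ∸ a) (λ b → f a *ℤ g (a ℕ.+ b ∸ a) *ℤ h (n ∸ (a ℕ.+ b))))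
      ≡⟨ ∑ℤ.∑≤-cong n (λ a _ → ∑ℤ.∑≤-cong (n ∸ a) (λ b _ →
           trans (cong₂ (λ u v → f a *ℤ g u *ℤ h v) (ℕ.m+n∸m≡n a b) (sym (ℕ.∸-+-assoc n a b)))
                 (ℤ.*-assoc (f a) (g b) (h (n ∸ a ∸ b))))) ⟩
    ∑≤ n (λ a → ∑≤ (n ∸ a) (λ b → f a *ℤ (g b *ℤ h (n ∸ a ∸ b))))
      ≡⟨ ∑ℤ.∑≤-cong n (λ a _ → sym (∑ℤ.*-distribˡ-∑≤ (n ∸ a) (f a) _)) ⟩
    ∑≤ n (λ a → f a *ℤ ∑≤ (n ∸ a) (λ b → g b *ℤ h (n ∸ a ∸ b)))
      ≡⟨ sym (trans (sumTo≡∑≤ n _) (∑ℤ.∑≤-cong n (λ a _ → cong (f a ℤ.*_) (sumTo≡∑≤ (n ∸ a) _)))) ⟩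
    sumTo n (λ a → f a *ℤ (g ⊗ h) (n ∸ a)) ∎

  -- The ring operations are opaque so that the ring solver compares normal forms
  -- without unfolding convolutions.
  opaque
    infixl 6 _⊞_
    infixl 7 _⊛_
    infix  8 ⊟_

    _⊞_ : Series → Series → Series
    (f ⊞ g) n = f n +ℤ g n

    ⊟_ : Series → Series
    (⊟ f) n = -ℤ f n

    _⊛_ : Series → Series → Series
    _⊛_ = _⊗_

    ⊞-coeff : ∀ f g n → (f ⊞ g) n ≡ f n +ℤ g n
    ⊞-coeff f g n = refl

    ⊟-coeff : ∀ f n → (⊟ f) n ≡ -ℤ f n
    ⊟-coeff f n = refl

    ⊛≗⊗ : ∀ f g → f ⊛ g ≗ f ⊗ g
    ⊛≗⊗ f g n = refl

    ⊛-isCommutativeRing : IsCommutativeRing _≗_ _⊞_ _⊛_ ⊟_ (λ _ → 0ℤ) one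
    ⊛-isCommutativeRing = record
      { isRing = record
          { +-isAbelianGroup = record
            { isGroup = record
              { isMonoid = record
                { isSemigroup = record
                  { isMagma = record
                    { isEquivalence = record
                      { refl = λ _ → refl ; sym = λ e n → sym (e n) ; trans = λ e e′ n → trans (e n) (e′ n) }
                    ; ∙-cong = λ e e′ n → cong₂ _+ℤ_ (e n) (e′ n) }
                  ; assoc = λ f g h n → ℤ.+-assoc (f n) (g n) (h n) }
                ; identity = (λ f n → ℤ.+-identityˡ (f n)) , (λ f n → ℤ.+-identityʳ (f n)) }
              ; inverse = (λ f n → ℤ.+-inverseˡ (f n)) , (λ f n → ℤ.+-inverseʳ (f n))
              ; ⁻¹-cong = λ e n → cong -ℤ_ (e n) }
            ; comm = λ f g n → ℤ.+-comm (f n) (g n) }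
          ; *-cong = ⊗-cong
          ; *-assoc = ⊗-assoc
          ; *-identity = ⊗-identityˡ , (λ f n → trans (⊗-comm f one n) (⊗-identityˡ f n))
          ; distrib = ⊗-distribˡ
                    , (λ f g h n → trans (⊗-comm (g ⊞ h) f n)
                                    (trans (⊗-distribˡ f g h n) (cong₂ _+ℤ_ (⊗-comm f g n) (⊗-comm f h n)))) }
        ; *-comm = ⊗-comm }

  seriesRing : CommutativeRing 0ℓ 0ℓ
  seriesRing = record
    { Carrier = Series ; _≈_ = _≗_ ; _+_ = _⊞_ ; _*_ = _⊛_ ; -_ = ⊟_ ; 0# = λ _ → 0ℤ ; 1# = one
    ; isCommutativeRing = ⊛-isCommutativeRing }

  module 𝕊 = CommutativeRing seriesRing
  open import Algebra.Properties.CommutativeSemiring.Exp 𝕊.commutativeSemiring using (_^_)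
  open import Algebra.Properties.Semiring.Mult 𝕊.semiring using () renaming (_×_ to _×ₙ_)
  open FiniteSums 𝕊.commutativeSemiring using (∏<; ∏<-split) renaming (∑≤ to ∑≤ˢ)

  q : Series
  q zero    = 0ℤ
  q (suc i) = one i

  open QBinomial 𝕊.commutativeSemiring q public
  open QPochhammer seriesRing q public

  q⊛-coeff-zero : ∀ G → (q ⊛ G) 0 ≡ 0ℤ
  q⊛-coeff-zero G = ⊛≗⊗ q G 0

  q⊛-coeff-suc : ∀ G t → (q ⊛ G) (suc t) ≡ G t
  q⊛-coeff-suc G t = begin
    (q ⊛ G) (suc t)                          ≡⟨ trans (⊛≗⊗ q G (suc t)) (sumTo≡∑≤ (suc t) _) ⟩
    ∑≤ (suc t) (λ i → q i *ℤ G (suc t ∸ i))  ≡⟨ ∑ℤ.∑≤-unfoldˡ t _ ⟩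
    0ℤ +ℤ ∑≤ t (λ i → one i *ℤ G (t ∸ i))    ≡⟨ ℤ.+-identityˡ _ ⟩
    ∑≤ t (λ i → one i *ℤ G (t ∸ i))          ≡⟨ sumTo≡∑≤ t _ ⟨
    (one ⊗ G) t                              ≡⟨ ⊗-identityˡ G t ⟩
    G t                                      ∎

  q^⊛-coeff-shift : ∀ e G t → (q ^ e ⊛ G) (e ℕ.+ t) ≡ G t
  q^⊛-coeff-shift zero    G t = 𝕊.*-identityˡ G t
  q^⊛-coeff-shift (suc e) G t =
    trans (𝕊.*-assoc q (q ^ e) G (suc e ℕ.+ t)) (trans (q⊛-coeff-suc (q ^ e ⊛ G) (e ℕ.+ t)) (q^⊛-coeff-shift e G t))

  q^⊛-coeff-below : ∀ e G t → t ℕ.< e → (q ^ e ⊛ G) t ≡ 0ℤ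
  q^⊛-coeff-below (suc e) G zero    _         = trans (𝕊.*-assoc q (q ^ e) G 0) (q⊛-coeff-zero (q ^ e ⊛ G))
  q^⊛-coeff-below (suc e) G (suc t) (s≤s t<e) =
    trans (𝕊.*-assoc q (q ^ e) G (suc t)) (trans (q⊛-coeff-suc (q ^ e ⊛ G) t) (q^⊛-coeff-below e G t t<e))

  q^-coeff : ∀ e t → (q ^ e) t ≡ (q ^ e ⊛ one) t
  q^-coeff e t = sym (𝕊.*-identityʳ (q ^ e) t)

  q^-coeff-below : ∀ e t → t ℕ.< e → (q ^ e) t ≡ 0ℤ
  q^-coeff-below e t t<e = trans (q^-coeff e t) (q^⊛-coeff-below e one t t<e)

  q^-coeff-self : ∀ e → (q ^ e) e ≡ 1ℤ
  q^-coeff-self e = trans (q^-coeff e e) (trans (cong (q ^ e ⊛ one) (sym (ℕ.+-identityʳ e))) (q^⊛-coeff-shift e one 0))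

  q^-coeff-above : ∀ e t → e ℕ.< t → (q ^ e) t ≡ 0ℤ
  q^-coeff-above e t e<t = begin
    (q ^ e) t                              ≡⟨ cong (q ^ e) (sym t≡e+suc) ⟩
    (q ^ e) (e ℕ.+ suc (t ∸ suc e))        ≡⟨ q^-coeff e _ ⟩
    (q ^ e ⊛ one) (e ℕ.+ suc (t ∸ suc e))  ≡⟨ q^⊛-coeff-shift e one (suc (t ∸ suc e)) ⟩
    0ℤ                                     ∎
    where
    t≡e+suc : e ℕ.+ suc (t ∸ suc e) ≡ t
    t≡e+suc = trans (ℕ.+-suc e (t ∸ suc e)) (ℕ.m+[n∸m]≡n e<t)

  q^-coeff-≢ : ∀ e t → t ≢ e → (q ^ e) t ≡ 0ℤ
  q^-coeff-≢ e t t≢e with ℕ.<-cmp t e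
  ... | tri< t<e _ _ = q^-coeff-below e t t<e
  ... | tri≈ _ t≡e _ = contradiction t≡e t≢e
  ... | tri> _ _ e<t = q^-coeff-above e t e<t

  oneMinusQ^≗1-q^ : ∀ m → oneMinusQ^ (suc m) ≗ 1-q^ (suc m)
  oneMinusQ^≗1-q^ m t = sym (begin
    (one ⊞ ⊟ q ^ suc m) t      ≡⟨ trans (⊞-coeff one _ t) (cong (λ c → one t +ℤ c) (⊟-coeff (q ^ suc m) t)) ⟩
    one t +ℤ -ℤ (q ^ suc m) t  ≡⟨ coefficients t ⟩
    oneMinusQ^ (suc m) t       ∎)
    where
    coefficients : ∀ t → one t +ℤ -ℤ (q ^ suc m) t ≡ oneMinusQ^ (suc m) t
    coefficients t with t ℕ.≟ 0 | t ℕ.≟ suc m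
    ... | yes refl | _       = cong (λ c → 1ℤ +ℤ -ℤ c) (q^-coeff-below (suc m) 0 (s≤s z≤n))
    ... | no t≢0   | yes refl = cong (λ c → 0ℤ +ℤ -ℤ c) (q^-coeff-self (suc m))
    ... | no t≢0   | no t≢sm  with t
    ...   | zero  = contradiction refl t≢0
    ...   | suc _ = cong (λ c → 0ℤ +ℤ -ℤ c) (q^-coeff-≢ (suc m) _ t≢sm)

  infix 4 _≈[≤_]_
  _≈[≤_]_ : Series → ℕ → Series → Set
  f ≈[≤ t ] g = ∀ p → p ℕ.≤ t → f p ≡ g p

  ≈[≤]-trans : ∀ {f g h t} → f ≈[≤ t ] g → g ≈[≤ t ] h → f ≈[≤ t ] h
  ≈[≤]-trans f≈g g≈h p p≤t = trans (f≈g p p≤t) (g≈h p p≤t)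

  ≈[≤]-sym : ∀ {f g t} → f ≈[≤ t ] g → g ≈[≤ t ] f
  ≈[≤]-sym f≈g p p≤t = sym (f≈g p p≤t)

  ≗⇒≈[≤] : ∀ {f g t} → f ≗ g → f ≈[≤ t ] g
  ≗⇒≈[≤] f≗g p _ = f≗g p

  ⊛-cong-≈[≤] : ∀ {f f′ g g′ t} → f ≈[≤ t ] f′ → g ≈[≤ t ] g′ → f ⊛ g ≈[≤ t ] f′ ⊛ g′
  ⊛-cong-≈[≤] {f} {f′} {g} {g′} f≈f′ g≈g′ p p≤t = begin
    (f ⊛ g) p    ≡⟨ ⊛≗⊗ f g p ⟩
    (f ⊗ g) p    ≡⟨ sumTo-cong p (λ i i≤p → cong₂ _*ℤ_ (f≈f′ i (ℕ.≤-trans i≤p p≤t))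
                                                       (g≈g′ (p ∸ i) (ℕ.≤-trans (ℕ.m∸n≤m p i) p≤t))) ⟩
    (f′ ⊗ g′) p  ≡⟨ ⊛≗⊗ f′ g′ p ⟨
    (f′ ⊛ g′) p  ∎

  1-q^≈[≤]one : ∀ i t → t ℕ.< i → 1-q^ i ≈[≤ t ] one
  1-q^≈[≤]one i t t<i p p≤t = begin
    (one ⊞ ⊟ q ^ i) p      ≡⟨ trans (⊞-coeff one _ p) (cong (λ c → one p +ℤ c) (⊟-coeff (q ^ i) p)) ⟩
    one p +ℤ -ℤ (q ^ i) p  ≡⟨ cong (λ c → one p +ℤ -ℤ c) (q^-coeff-below i p (ℕ.≤-<-trans p≤t t<i)) ⟩
    one p +ℤ 0ℤ            ≡⟨ ℤ.+-identityʳ (one p) ⟩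
    one p                  ∎

  ∏<≈[≤]one : ∀ n t (f : ℕ → Series) → (∀ j → j ℕ.< n → f j ≈[≤ t ] one) → ∏< n f ≈[≤ t ] one
  ∏<≈[≤]one zero    t f f≈1 p _ = refl
  ∏<≈[≤]one (suc n) t f f≈1 = ≈[≤]-trans
    (⊛-cong-≈[≤] (∏<≈[≤]one n t f (λ j j<n → f≈1 j (ℕ.m≤n⇒m≤1+n j<n))) (f≈1 n ℕ.≤-refl))
    (≗⇒≈[≤] (𝕊.*-identityˡ one))

  topPoch≈[≤]one : ∀ N k t → t ℕ.+ k ℕ.≤ N → topPoch N k ≈[≤ t ] one
  topPoch≈[≤]one N k t t+k≤N = ∏<≈[≤]one k t _ (λ i i<k →
    1-q^≈[≤]one (N ∸ i) t (ℕ.m+n≤o⇒m≤o∸n (suc t) (ℕ.<-≤-trans (ℕ.+-monoʳ-< t i<k) t+k≤N)))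

  poch-stable : ∀ t M → t ℕ.≤ M → poch M ≈[≤ t ] poch t
  poch-stable t M t≤M rewrite ≡.sym (ℕ.m+[n∸m]≡n t≤M) = ≈[≤]-trans
    (≗⇒≈[≤] (∏<-split t (M ∸ t) (λ i → 1-q^ (suc i))))
    (≈[≤]-trans
      (⊛-cong-≈[≤] (λ _ _ → refl) (∏<≈[≤]one (M ∸ t) t _ (λ i _ → 1-q^≈[≤]one _ t (s≤s (ℕ.m≤m+n t i)))))
      (≗⇒≈[≤] (𝕊.*-identityʳ (poch t))))

  qBinomial-poch≈[≤]one : ∀ N k t M → t ℕ.≤ k → t ℕ.+ k ℕ.≤ N → t ℕ.≤ M → qBinomial N k ⊛ poch M ≈[≤ t ] one
  qBinomial-poch≈[≤]one N k t M t≤k t+k≤N t≤M = ≈[≤]-trans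
    (⊛-cong-≈[≤] {qBinomial N k} (λ _ _ → refl) (≈[≤]-trans (poch-stable t M t≤M) (≈[≤]-sym (poch-stable t k t≤k))))
    (≈[≤]-trans (≗⇒≈[≤] (qBinomial-poch N k (ℕ.m+n≤o⇒n≤o t t+k≤N))) (topPoch≈[≤]one N k t t+k≤N))

  ∑≤-coeff : ∀ N (f : ℕ → Series) t → ∑≤ˢ N f t ≡ ∑≤ N (λ k → f k t)
  ∑≤-coeff zero    f t = refl
  ∑≤-coeff (suc N) f t = trans (⊞-coeff (∑≤ˢ N f) (f (suc N)) t) (cong (_+ℤ f (suc N) t) (∑≤-coeff N f t))

  IsConstant : Series → Set
  IsConstant c = ∀ p → c (suc p) ≡ 0ℤ

  constant-⊛-coeff : ∀ c G → IsConstant c → ∀ t → (c ⊛ G) t ≡ c 0 *ℤ G t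
  constant-⊛-coeff c G c-const zero    = ⊛≗⊗ c G 0
  constant-⊛-coeff c G c-const (suc t) = begin
    (c ⊛ G) (suc t)                                          ≡⟨ trans (⊛≗⊗ c G (suc t)) (sumTo≡∑≤ (suc t) _) ⟩
    ∑≤ (suc t) (λ i → c i *ℤ G (suc t ∸ i))                  ≡⟨ ∑ℤ.∑≤-unfoldˡ t _ ⟩
    c 0 *ℤ G (suc t) +ℤ ∑≤ t (λ i → c (suc i) *ℤ G (t ∸ i))  ≡⟨ cong (λ s → c 0 *ℤ G (suc t) +ℤ s)
                                                                   (∑ℤ.∑≤-zero t (λ i _ → cong (_*ℤ G (t ∸ i)) (c-const i))) ⟩
    c 0 *ℤ G (suc t) +ℤ 0ℤ                                   ≡⟨ ℤ.+-identityʳ _ ⟩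
    c 0 *ℤ G (suc t)                                         ∎

  IsConstant-one : IsConstant one
  IsConstant-one p = refl

  IsConstant-⊟ : ∀ {c} → IsConstant c → IsConstant (⊟ c)
  IsConstant-⊟ {c} c-const p = trans (⊟-coeff c (suc p)) (cong -ℤ_ (c-const p))

  IsConstant-⊛ : ∀ {c d} → IsConstant c → IsConstant d → IsConstant (c ⊛ d)
  IsConstant-⊛ {c} {d} c-const d-const p =
    trans (constant-⊛-coeff c d c-const (suc p)) (trans (cong (c 0 *ℤ_) (d-const p)) (ℤ.*-zeroʳ (c 0)))

  IsConstant-^ : ∀ {c} → IsConstant c → ∀ k → IsConstant (c ^ k)
  IsConstant-^ c-const zero    = IsConstant-one
  IsConstant-^ c-const (suc k) = IsConstant-⊛ c-const (IsConstant-^ c-const k)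

  IsConstant-×ₙ : ∀ m → IsConstant (m ×ₙ one)
  IsConstant-×ₙ zero    p = refl
  IsConstant-×ₙ (suc m) p = trans (⊞-coeff one (m ×ₙ one) (suc p)) (cong (0ℤ +ℤ_) (IsConstant-×ₙ m p))

module JacobiExponents where

  open import Data.Nat using (_+_; _*_; _^_; _≤_; _≤?_)
  open import Data.Nat.Properties
  open import Data.Nat.Tactic.RingSolver using (solve-∀)
  open import Relation.Nullary using (yes; no)
  open ≡ using (refl; sym; trans; cong; subst)

  C₂-+ : ∀ a b → C₂ (a + b) ≡ C₂ a + C₂ b + a * b
  C₂-+ zero    b = sym (+-identityʳ (C₂ b))
  C₂-+ (suc a) b rewrite C₂-+ a b = lemma a b (C₂ a) (C₂ b)
    where
    lemma : ∀ a b ca cb → a + b + (ca + cb + a * b) ≡ a + ca + cb + suc a * b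
    lemma = solve-∀

  2*C₂+n≡n² : ∀ n → 2 * C₂ n + n ≡ n * n
  2*C₂+n≡n² zero    = refl
  2*C₂+n≡n² (suc n) = begin
    2 * (n + C₂ n) + suc n      ≡⟨ lemma n (C₂ n) ⟩
    (2 * C₂ n + n) + 2 * n + 1  ≡⟨ cong (λ m → m + 2 * n + 1) (2*C₂+n≡n² n) ⟩
    n * n + 2 * n + 1           ≡⟨ square n ⟩
    suc n * suc n               ∎
    where
    open ≡.≡-Reasoning
    lemma : ∀ n c → 2 * (n + c) + suc n ≡ (2 * c + n) + 2 * n + 1
    lemma = solve-∀
    square : ∀ n → n * n + 2 * n + 1 ≡ suc n * suc n
    square = solve-∀

  odd² : ∀ j → (2 * j + 1) ^ 2 ≡ 8 * C₂ (suc j) + 1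
  odd² j = begin
    (2 * j + 1) ^ 2                 ≡⟨ expand j ⟩
    4 * (j * j) + 4 * j + 1         ≡⟨ cong (λ m → 4 * m + 4 * j + 1) (2*C₂+n≡n² j) ⟨
    4 * (2 * C₂ j + j) + 4 * j + 1  ≡⟨ collect j (C₂ j) ⟩
    8 * C₂ (suc j) + 1              ∎
    where
    open ≡.≡-Reasoning
    expand : ∀ j → (2 * j + 1) * ((2 * j + 1) * 1) ≡ 4 * (j * j) + 4 * j + 1
    expand = solve-∀
    collect : ∀ j c → 4 * (2 * c + j) + 4 * j + 1 ≡ 8 * (j + c) + 1
    collect = solve-∀

  jacobiShift : ℕ → ℕ
  jacobiShift n = C₂ n + (n + n * n)

  jacobiExponent : ℕ → ℕ → ℕ
  jacobiExponent n k = C₂ k + n * (n + suc n ∸ k)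

  -- The k-th term of FiniteJacobi.finiteJacobi sits at q^(jacobiShift n + T) with T = C₂ (suc j) triangular;
  -- the bounds make its factor [N k](q;q)ₙ ≡ 1 up to the degree n - T that matters.
  record ExponentSplit (n k : ℕ) : Set where
    field
      j        : ℕ
      exponent : jacobiExponent n k ≡ jacobiShift n + C₂ (suc j)
      bounds   : ∀ p → C₂ (suc j) + p ≡ n → p ≤ k × p + k ≤ n + suc n

  private
    lowSplit : ∀ k j → ExponentSplit (k + j) k
    lowSplit k j = record { j = j ; exponent = exponent ; bounds = bounds }
      where
      open ≡.≡-Reasoning
      expand : ∀ ck k j → ck + (k + j) * (j + suc (k + j)) ≡ ck + k * k + 3 * (k * j) + k + j + j * j + j * j
      expand = solve-∀
      collect : ∀ ck cj k j →
        ck + k * k + 3 * (k * j) + k + j + (2 * cj + j) + j * j ≡ ck + cj + k * j + (k + j + (k + j) * (k + j)) + (j + cj)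
      collect = solve-∀
      exponent : jacobiExponent (k + j) k ≡ jacobiShift (k + j) + C₂ (suc j)
      exponent = begin
        C₂ k + (k + j) * ((k + j) + suc (k + j) ∸ k)
          ≡⟨ cong (λ m → C₂ k + (k + j) * m) (trans (cong (_∸ k) (+-assoc k j _)) (m+n∸m≡n k _)) ⟩
        C₂ k + (k + j) * (j + suc (k + j))
          ≡⟨ expand (C₂ k) k j ⟩
        C₂ k + k * k + 3 * (k * j) + k + j + j * j + j * j
          ≡⟨ cong (λ m → C₂ k + k * k + 3 * (k * j) + k + j + m + j * j) (2*C₂+n≡n² j) ⟨
        C₂ k + k * k + 3 * (k * j) + k + j + (2 * C₂ j + j) + j * j
          ≡⟨ collect (C₂ k) (C₂ j) k j ⟩
        C₂ k + C₂ j + k * j + (k + j + (k + j) * (k + j)) + (j + C₂ j)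
          ≡⟨ cong (λ m → m + (k + j + (k + j) * (k + j)) + C₂ (suc j)) (C₂-+ k j) ⟨
        jacobiShift (k + j) + C₂ (suc j) ∎
      bounds : ∀ p → C₂ (suc j) + p ≡ k + j → p ≤ k × p + k ≤ (k + j) + suc (k + j)
      bounds p T+p≡n = p≤k , ≤-trans (+-monoˡ-≤ k p≤k) (+-mono-≤ (m≤m+n k j) (≤-trans (m≤m+n k j) (n≤1+n _)))
        where
        p≤k : p ≤ k
        p≤k = m+n≤o⇒n≤o (C₂ j) (≤-reflexive (+-cancelˡ-≡ j _ _ (trans (sym (+-assoc j (C₂ j) p)) (trans T+p≡n (+-comm k j)))))

    highSplit : ∀ i r → ExponentSplit (i + r) (suc (i + r) + i)
    highSplit i r = record { j = i ; exponent = exponent ; bounds = bounds }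
      where
      open ≡.≡-Reasoning
      N≡k+r : ∀ i r → (i + r) + suc (i + r) ≡ (suc (i + r) + i) + r
      N≡k+r = solve-∀
      collect : ∀ i r ci cr →
        i + r + (ci + cr + i * r) + ci + suc (i + r) * i + (i + r) * r ≡ ci + cr + i * r + (i + r + (i + r) * (i + r)) + (i + ci)
      collect = solve-∀
      exponent : jacobiExponent (i + r) (suc (i + r) + i) ≡ jacobiShift (i + r) + C₂ (suc i)
      exponent = begin
        C₂ (suc (i + r) + i) + (i + r) * ((i + r) + suc (i + r) ∸ (suc (i + r) + i))
          ≡⟨ cong (λ m → C₂ (suc (i + r) + i) + (i + r) * m)
                  (trans (cong (_∸ (suc (i + r) + i)) (N≡k+r i r)) (m+n∸m≡n (suc (i + r) + i) r)) ⟩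
        C₂ (suc (i + r) + i) + (i + r) * r
          ≡⟨ cong (_+ (i + r) * r) (trans (C₂-+ (suc (i + r)) i) (cong (λ m → i + r + m + C₂ i + suc (i + r) * i) (C₂-+ i r))) ⟩
        i + r + (C₂ i + C₂ r + i * r) + C₂ i + suc (i + r) * i + (i + r) * r
          ≡⟨ collect i r (C₂ i) (C₂ r) ⟩
        C₂ i + C₂ r + i * r + (i + r + (i + r) * (i + r)) + (i + C₂ i)
          ≡⟨ cong (λ m → m + (i + r + (i + r) * (i + r)) + C₂ (suc i)) (C₂-+ i r) ⟨
        jacobiShift (i + r) + C₂ (suc i) ∎
      bounds : ∀ p → C₂ (suc i) + p ≡ i + r → p ≤ suc (i + r) + i × p + (suc (i + r) + i) ≤ (i + r) + suc (i + r)
      bounds p T+p≡n = ≤-trans p≤r (≤-trans (m≤n+m r i) (≤-trans (n≤1+n _) (m≤m+n _ i))) ,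
                       ≤-trans (+-monoˡ-≤ (suc (i + r) + i) p≤r) (≤-reflexive (trans (+-comm r _) (sym (N≡k+r i r))))
        where
        p≤r : p ≤ r
        p≤r = m+n≤o⇒n≤o (C₂ i) (≤-reflexive (+-cancelˡ-≡ i _ _ (trans (sym (+-assoc i (C₂ i) p)) T+p≡n)))

  exponentSplit : ∀ n k → k ≤ n + suc n → ExponentSplit n k
  exponentSplit n k k≤N with k ≤? n
  ... | yes k≤n = subst (λ m → ExponentSplit m k) (m+[n∸m]≡n k≤n) (lowSplit k (n ∸ k))
  ... | no  k≰n = subst (ExponentSplit n) (m+[n∸m]≡n n<k)
                    (subst (λ m → ExponentSplit m (suc m + i)) (m+[n∸m]≡n i≤n) (highSplit i (n ∸ i)))
    where
    n<k : suc n ≤ k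
    n<k = ≰⇒> k≰n
    i : ℕ
    i = k ∸ suc n
    i≤n : i ≤ n
    i≤n = +-cancelˡ-≤ (suc n) i n (≤-trans (≤-reflexive (m+[n∸m]≡n n<k)) (≤-trans k≤N (≤-reflexive (+-comm n (suc n)))))

module FiniteJacobi (n : ℕ) where

  open import Data.Integer using (0ℤ)
  open PowerSeries
  open JacobiExponents
  open import Algebra.Properties.CommutativeSemiring.Exp 𝕊.commutativeSemiring using (_^_; ^-homo-*; ^-assocʳ; ^-distrib-*; ^-congˡ)
  open import Algebra.Properties.Semiring.Mult 𝕊.semiring using () renaming (_×_ to _×ₙ_)
  open import Algebra.Properties.Ring 𝕊.ring using (-1*x≈-x; -‿involutive)
  open import Algebra.Solver.Ring.NaturalCoefficients.Default 𝕊.commutativeSemiring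
  open import Relation.Binary.Reasoning.Setoid 𝕊.setoid
  open FiniteSums 𝕊.commutativeSemiring
  open DualNumbers 𝕊.commutativeSemiring
  open import Algebra.Properties.CommutativeSemiring.Exp dualSemiring using () renaming (_^_ to _^ᴰ_)
  module QBᴰ = QBinomial dualSemiring (ι q)

  N : ℕ
  N = n ℕ.+ suc n

  Q : Series
  Q = poch n

  sign : Series
  sign = (⊟ one) ^ n

  weight : ℕ → Series
  weight k = sign ⊛ ((⊟ one) ^ k ⊛ ((N ∸ k) ×ₙ one))

  term : ℕ → Series
  term k = q ^ jacobiExponent n k ⊛ (qBinomial N k ⊛ Q)

  private
    a : Series
    a = q ^ n

    x y : Dual
    x = ι (⊟ one)
    y = (a , a)

    F : ℕ → Dual
    F i = y +ᴰ x *ᴰ ι q ^ᴰ i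

    F-parts : ∀ i → F i ≈ᴰ (a 𝕊.- q ^ i , a)
    F-parts i = 𝔻.trans (𝔻.+-congˡ (𝔻.trans (𝔻.*-congˡ (ι-^ q i)) (ι-* (⊟ one) (q ^ i))))
                        (𝕊.+-congˡ (-1*x≈-x (q ^ i)) , 𝕊.+-identityʳ a)

    central-real : proj₁ (F (n ℕ.+ 0)) ≗ λ _ → 0ℤ
    central-real = begin
      proj₁ (F (n ℕ.+ 0))  ≈⟨ proj₁ (F-parts (n ℕ.+ 0)) ⟩
      a 𝕊.- q ^ (n ℕ.+ 0)  ≡⟨ ≡.cong (λ m → a 𝕊.- q ^ m) (ℕ.+-identityʳ n) ⟩
      a 𝕊.- a              ≈⟨ 𝕊.-‿inverseʳ a ⟩
      (λ _ → 0ℤ)           ∎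

    proj₂-∏F : proj₂ (∑ᴰ.∏< N F) ≗ ∏< n (λ i → a 𝕊.- q ^ i) ⊛ (a ⊛ ∏< n (λ i → a 𝕊.- q ^ (n ℕ.+ suc i)))
    proj₂-∏F = begin
      proj₂ (∑ᴰ.∏< N F)
        ≈⟨ proj₂ (𝔻.trans (∑ᴰ.∏<-split n (suc n) F) (𝔻.*-congˡ (∑ᴰ.∏<-unfoldˡ n (λ i → F (n ℕ.+ i))))) ⟩
      proj₂ (X *ᴰ (F (n ℕ.+ 0) *ᴰ Y))
        ≈⟨ proj₂-*ᴰ-nilpotent X (F (n ℕ.+ 0)) Y central-real ⟩
      proj₁ X ⊛ (proj₂ (F (n ℕ.+ 0)) ⊛ proj₁ Y)
        ≈⟨ 𝕊.*-cong (𝕊.trans (proj₁-∏< n F) (∏<-cong n (λ i _ → proj₁ (F-parts i))))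
                    (𝕊.*-cong (proj₂ (F-parts (n ℕ.+ 0)))
                              (𝕊.trans (proj₁-∏< n _) (∏<-cong n (λ i _ → proj₁ (F-parts (n ℕ.+ suc i)))))) ⟩
      ∏< n (λ i → a 𝕊.- q ^ i) ⊛ (a ⊛ ∏< n (λ i → a 𝕊.- q ^ (n ℕ.+ suc i))) ∎
      where
      X Y : Dual
      X = ∑ᴰ.∏< n F
      Y = ∑ᴰ.∏< n (λ i → F (n ℕ.+ suc i))

    lhs : proj₂ (∑ᴰ.∏< N F) ⊛ Q ≗ sign ⊛ (q ^ jacobiShift n ⊛ (Q ⊛ (Q ⊛ Q)))
    lhs = begin
      proj₂ (∑ᴰ.∏< N F) ⊛ Q
        ≈⟨ 𝕊.*-congʳ (𝕊.trans proj₂-∏F (𝕊.*-cong (∏<-q^-q^-below n) (𝕊.*-congˡ (∏<-q^-q^-above n)))) ⟩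
      (sign ⊛ q ^ C₂ n ⊛ Q) ⊛ (a ⊛ (q ^ (n ℕ.* n) ⊛ Q)) ⊛ Q
        ≈⟨ solve 5 (λ s A Q a B → (s :* A :* Q) :* (a :* (B :* Q)) :* Q := s :* ((A :* (a :* B)) :* (Q :* (Q :* Q))))
             𝕊.refl sign (q ^ C₂ n) Q a (q ^ (n ℕ.* n)) ⟩
      sign ⊛ ((q ^ C₂ n ⊛ (q ^ n ⊛ q ^ (n ℕ.* n))) ⊛ (Q ⊛ (Q ⊛ Q)))
        ≈⟨ 𝕊.*-congˡ (𝕊.*-congʳ (𝕊.sym (𝕊.trans (^-homo-* q (C₂ n) _) (𝕊.*-congˡ (^-homo-* q n (n ℕ.* n)))))) ⟩
      sign ⊛ (q ^ jacobiShift n ⊛ (Q ⊛ (Q ⊛ Q))) ∎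

    rhs-term : ∀ k → proj₂ (QBᴰ.rotheTerm N x y k) ⊛ Q ≗ ((⊟ one) ^ k ⊛ ((N ∸ k) ×ₙ one)) ⊛ term k
    rhs-term k = begin
      proj₂ (QBᴰ.rotheTerm N x y k) ⊛ Q
        ≈⟨ 𝕊.*-congʳ (proj₂ (𝔻.*-congʳ {y ^ᴰ m} coefficient)) ⟩
      proj₂ (ι c *ᴰ y ^ᴰ m) ⊛ Q
        ≈⟨ 𝕊.*-congʳ (𝕊.trans (proj₂-ι-*ᴰ c (y ^ᴰ m)) (𝕊.*-congˡ (proj₂ ([1+ε]-^ a m)))) ⟩
      c ⊛ (a ^ m ⊛ (m ×ₙ one)) ⊛ Q
        ≈⟨ solve 6 (λ b p s A M Q → (b :* p :* s) :* (A :* M) :* Q := (s :* M) :* ((p :* A) :* (b :* Q)))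
             𝕊.refl (qBinomial N k) (q ^ C₂ k) ((⊟ one) ^ k) (a ^ m) (m ×ₙ one) Q ⟩
      ((⊟ one) ^ k ⊛ (m ×ₙ one)) ⊛ ((q ^ C₂ k ⊛ a ^ m) ⊛ (qBinomial N k ⊛ Q))
        ≈⟨ 𝕊.*-congˡ (𝕊.*-congʳ (𝕊.trans (𝕊.*-congˡ (^-assocʳ q n m)) (𝕊.sym (^-homo-* q (C₂ k) (n ℕ.* m))))) ⟩
      ((⊟ one) ^ k ⊛ (m ×ₙ one)) ⊛ term k ∎
      where
      m : ℕ
      m = N ∸ k
      c : Series
      c = qBinomial N k ⊛ q ^ C₂ k ⊛ (⊟ one) ^ k
      coefficient : QBᴰ.qBinomial N k *ᴰ ι q ^ᴰ C₂ k *ᴰ x ^ᴰ k ≈ᴰ ι c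
      coefficient = 𝔻.trans (𝔻.*-cong (𝔻.trans (𝔻.*-cong (qBinomial-ι q N k) (ι-^ q (C₂ k))) (ι-* _ _)) (ι-^ (⊟ one) k))
                            (ι-* _ _)

    sign² : sign ⊛ sign ≗ one
    sign² = 𝕊.trans (𝕊.sym (^-distrib-* (⊟ one) (⊟ one) n))
                    (𝕊.trans (^-congˡ n (𝕊.trans (-1*x≈-x (⊟ one)) (-‿involutive one))) (1^ n))
      where
      1^ : ∀ m → one ^ m ≗ one
      1^ zero    = 𝕊.refl
      1^ (suc m) = 𝕊.trans (𝕊.*-identityˡ _) (1^ m)

  -- The ε-part of the q-binomial theorem at x = -1, y = qⁿ(1 + ε), multiplied by (q;q)ₙ.
  finiteJacobi : q ^ jacobiShift n ⊛ (Q ⊛ (Q ⊛ Q)) ≗ ∑≤ N (λ k → weight k ⊛ term k)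
  finiteJacobi = begin
    L                                      ≈⟨ 𝕊.trans (𝕊.sym (𝕊.*-identityˡ L)) (𝕊.*-congʳ (𝕊.sym sign²)) ⟩
    sign ⊛ sign ⊛ L                        ≈⟨ 𝕊.trans (𝕊.*-assoc sign sign L) (𝕊.*-congˡ (𝕊.sym lhs)) ⟩
    sign ⊛ (proj₂ (∑ᴰ.∏< N F) ⊛ Q)         ≈⟨ 𝕊.*-congˡ (𝕊.*-congʳ (proj₂ (QBᴰ.rothe N x y))) ⟩
    sign ⊛ (proj₂ (∑ᴰ.∑≤ N T) ⊛ Q)         ≈⟨ 𝕊.*-congˡ (𝕊.*-congʳ (proj₂-∑≤ N T)) ⟩
    sign ⊛ (∑≤ N (λ k → proj₂ (T k)) ⊛ Q)  ≈⟨ 𝕊.*-congˡ (*-distribʳ-∑≤ N Q (λ k → proj₂ (T k))) ⟩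
    sign ⊛ ∑≤ N (λ k → proj₂ (T k) ⊛ Q)    ≈⟨ *-distribˡ-∑≤ N sign (λ k → proj₂ (T k) ⊛ Q) ⟩
    ∑≤ N (λ k → sign ⊛ (proj₂ (T k) ⊛ Q))  ≈⟨ ∑≤-cong N (λ k _ → 𝕊.trans (𝕊.*-congˡ (rhs-term k))
                                                                       (𝕊.sym (𝕊.*-assoc sign _ (term k)))) ⟩
    ∑≤ N (λ k → weight k ⊛ term k)         ∎
    where
    L : Series
    L = q ^ jacobiShift n ⊛ (Q ⊛ (Q ⊛ Q))
    T : ℕ → Dual
    T = QBᴰ.rotheTerm N x y

module JacobiCoefficients (n : ℕ) where

  open import Data.Integer using (0ℤ) renaming (_*_ to _*ℤ_)
  import Data.Integer.Properties as ℤ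
  open import Relation.Binary.Definitions using (Tri; tri<; tri≈; tri>)
  open import Relation.Nullary using (contradiction)
  open ≡.≡-Reasoning
  open PowerSeries
  open JacobiExponents
  open FiniteJacobi n
  open import Algebra.Properties.CommutativeSemiring.Exp 𝕊.commutativeSemiring using (_^_)
  open FiniteSums 𝕊.commutativeSemiring using () renaming (∑≤ to ∑≤ˢ)

  weight-constant : ∀ k → IsConstant (weight k)
  weight-constant k =
    IsConstant-⊛ (IsConstant-^ −1-constant n) (IsConstant-⊛ (IsConstant-^ −1-constant k) (IsConstant-×ₙ (N ∸ k)))
    where
    −1-constant : IsConstant (⊟ one)
    −1-constant = IsConstant-⊟ IsConstant-one

  term-coeff-vanishes : (∀ j → C₂ (suc j) ≢ n) → ∀ k → k ℕ.≤ N → term k (jacobiShift n ℕ.+ n) ≡ 0ℤ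
  term-coeff-vanishes non-triangular k k≤N = begin
    (q ^ jacobiExponent n k ⊛ G) (S ℕ.+ n)  ≡⟨ ≡.cong (λ e → (q ^ e ⊛ G) (S ℕ.+ n)) exponent ⟩
    (q ^ (S ℕ.+ T) ⊛ G) (S ℕ.+ n)           ≡⟨ coefficient (ℕ.<-cmp n T) ⟩
    0ℤ                                       ∎
    where
    open ExponentSplit (exponentSplit n k k≤N)
    S T : ℕ
    S = jacobiShift n
    T = C₂ (suc j)
    G : Series
    G = qBinomial N k ⊛ Q

    G-coeff : ∀ p → T ℕ.+ p ≡ n → G p ≡ 0ℤ
    G-coeff zero    T+0≡n = contradiction (≡.trans (≡.sym (ℕ.+-identityʳ T)) T+0≡n) (non-triangular j)
    G-coeff (suc p) T+p≡n = qBinomial-poch≈[≤]one N k (suc p) n (proj₁ (bounds (suc p) T+p≡n))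
      (proj₂ (bounds (suc p) T+p≡n)) (ℕ.m+n≤o⇒n≤o T (ℕ.≤-reflexive T+p≡n)) (suc p) ℕ.≤-refl

    coefficient : Tri (n ℕ.< T) (n ≡ T) (T ℕ.< n) → (q ^ (S ℕ.+ T) ⊛ G) (S ℕ.+ n) ≡ 0ℤ
    coefficient (tri< n<T _ _) = q^⊛-coeff-below (S ℕ.+ T) G (S ℕ.+ n) (ℕ.+-monoʳ-< S n<T)
    coefficient (tri≈ _ n≡T _) = contradiction (≡.sym n≡T) (non-triangular j)
    coefficient (tri> _ _ T<n) = begin
      (q ^ (S ℕ.+ T) ⊛ G) (S ℕ.+ n)                ≡⟨ ≡.cong (q ^ (S ℕ.+ T) ⊛ G) index ⟩
      (q ^ (S ℕ.+ T) ⊛ G) ((S ℕ.+ T) ℕ.+ (n ∸ T))  ≡⟨ q^⊛-coeff-shift (S ℕ.+ T) G (n ∸ T) ⟩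
      G (n ∸ T)                                     ≡⟨ G-coeff (n ∸ T) (ℕ.m+[n∸m]≡n (ℕ.<⇒≤ T<n)) ⟩
      0ℤ                                            ∎
      where
      index : S ℕ.+ n ≡ (S ℕ.+ T) ℕ.+ (n ∸ T)
      index = ≡.trans (≡.cong (S ℕ.+_) (≡.sym (ℕ.m+[n∸m]≡n (ℕ.<⇒≤ T<n)))) (≡.sym (ℕ.+-assoc S T (n ∸ T)))

  poch³-coeff-nontriangular : (∀ j → C₂ (suc j) ≢ n) → (Q ⊛ (Q ⊛ Q)) n ≡ 0ℤ
  poch³-coeff-nontriangular non-triangular = begin
    (Q ⊛ (Q ⊛ Q)) n                                ≡⟨ q^⊛-coeff-shift S (Q ⊛ (Q ⊛ Q)) n ⟨
    (q ^ S ⊛ (Q ⊛ (Q ⊛ Q))) (S ℕ.+ n)             ≡⟨ finiteJacobi (S ℕ.+ n) ⟩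
    ∑≤ˢ N (λ k → weight k ⊛ term k) (S ℕ.+ n)      ≡⟨ ∑≤-coeff N (λ k → weight k ⊛ term k) (S ℕ.+ n) ⟩
    ∑ℤ.∑≤ N (λ k → (weight k ⊛ term k) (S ℕ.+ n))  ≡⟨ ∑ℤ.∑≤-zero N vanishing ⟩
    0ℤ                                             ∎
    where
    S : ℕ
    S = jacobiShift n
    vanishing : ∀ k → k ℕ.≤ N → (weight k ⊛ term k) (S ℕ.+ n) ≡ 0ℤ
    vanishing k k≤N = begin
      (weight k ⊛ term k) (S ℕ.+ n)      ≡⟨ constant-⊛-coeff (weight k) (term k) (weight-constant k) (S ℕ.+ n) ⟩
      weight k 0 *ℤ term k (S ℕ.+ n)     ≡⟨ ≡.cong (weight k 0 *ℤ_) (term-coeff-vanishes non-triangular k k≤N) ⟩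
      weight k 0 *ℤ 0ℤ                   ≡⟨ ℤ.*-zeroʳ (weight k 0) ⟩
      0ℤ                                 ∎

module BorweinProduct where

  open import Data.Integer using (0ℤ) renaming (_*_ to _*ℤ_)
  import Data.Integer.Properties as ℤ
  open import Data.Nat.Divisibility using (_∣_; _∣?_; ∣m∣n⇒∣m+n; m∣m*n; ∣-trans; _∣0)
  open import Relation.Nullary using (¬_; yes; no; contradiction)
  open ≡ using (refl; trans; cong; subst)
  open PowerSeries
  open import Algebra.Solver.Ring.NaturalCoefficients.Default 𝕊.commutativeSemiring
  open import Relation.Binary.Reasoning.Setoid 𝕊.setoid

  cube≗ : ∀ f → cube f ≗ f ⊛ (f ⊛ f)
  cube≗ f = 𝕊.sym (𝕊.trans (⊛≗⊗ f (f ⊛ f)) (⊗-cong {f} (λ _ → refl) (⊛≗⊗ f f)))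

  denominator : ℕ → ℕ → Series
  denominator k zero    = one
  denominator k (suc N) = denominator k N ⊛ (g ⊛ (g ⊛ g))
    where
    g : Series
    g = geom (k ℕ.* suc N)

  partialProd-factor : ∀ k N → partialProd k N ≗ (poch N ⊛ (poch N ⊛ poch N)) ⊛ denominator k N
  partialProd-factor k zero    = 𝕊.sym (𝕊.trans (𝕊.*-identityʳ _) (𝕊.trans (𝕊.*-identityˡ _) (𝕊.*-identityˡ one)))
  partialProd-factor k (suc N) = begin
    partialProd k N ⊗ (cube (oneMinusQ^ (suc N)) ⊗ cube g)
      ≈⟨ 𝕊.sym (𝕊.trans (⊛≗⊗ (partialProd k N) _)
                        (⊗-cong {partialProd k N} (λ _ → refl) (⊛≗⊗ (cube (oneMinusQ^ (suc N))) (cube g)))) ⟩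
    partialProd k N ⊛ (cube (oneMinusQ^ (suc N)) ⊛ cube g)
      ≈⟨ 𝕊.*-cong (partialProd-factor k N) (𝕊.*-cong (𝕊.trans (cube≗ _) (𝕊.*-cong e (𝕊.*-cong e e))) (cube≗ g)) ⟩
    (P ⊛ (P ⊛ P) ⊛ D) ⊛ (E ⊛ (E ⊛ E) ⊛ (g ⊛ (g ⊛ g)))
      ≈⟨ solve 4 (λ P D E g → (P :* (P :* P) :* D) :* (E :* (E :* E) :* (g :* (g :* g)))
                           := ((P :* E) :* ((P :* E) :* (P :* E))) :* (D :* (g :* (g :* g)))) 𝕊.refl P D E g ⟩
    (poch (suc N) ⊛ (poch (suc N) ⊛ poch (suc N))) ⊛ denominator k (suc N) ∎
    where
    P D E g : Series
    P = poch N
    D = denominator k N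
    E = 1-q^ (suc N)
    g = geom (k ℕ.* suc N)
    e : oneMinusQ^ (suc N) ≗ E
    e = oneMinusQ^≗1-q^ N

  SupportedOnMultiplesOf : ℕ → Series → Set
  SupportedOnMultiplesOf k f = ∀ p → ¬ (k ∣ p) → f p ≡ 0ℤ

  one-supported : ∀ k → SupportedOnMultiplesOf k one
  one-supported k zero    k∤0 = contradiction (k ∣0) k∤0
  one-supported k (suc p) _   = refl

  ⊛-supported : ∀ {k f g} → SupportedOnMultiplesOf k f → SupportedOnMultiplesOf k g → SupportedOnMultiplesOf k (f ⊛ g)
  ⊛-supported {k} {f} {g} f-supp g-supp p k∤p = trans (⊛≗⊗ f g p) (sumTo-zero p term)
    where
    term : ∀ i → i ℕ.≤ p → f i *ℤ g (p ∸ i) ≡ 0ℤ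
    term i i≤p with k ∣? i | k ∣? (p ∸ i)
    ... | no k∤i | _         = cong (_*ℤ g (p ∸ i)) (f-supp i k∤i)
    ... | yes _  | no k∤p∸i  = trans (cong (f i *ℤ_) (g-supp (p ∸ i) k∤p∸i)) (ℤ.*-zeroʳ (f i))
    ... | yes k∣i | yes k∣p∸i = contradiction (subst (k ∣_) (ℕ.m+[n∸m]≡n i≤p) (∣m∣n⇒∣m+n k∣i k∣p∸i)) k∤p

  geom-supported : ∀ k m → SupportedOnMultiplesOf k (geom (k ℕ.* m))
  geom-supported k m p k∤p with (k ℕ.* m) ∣? p
  ... | yes km∣p = contradiction (∣-trans (m∣m*n m) km∣p) k∤p
  ... | no  _    = refl

  denominator-supported : ∀ k N → SupportedOnMultiplesOf k (denominator k N)
  denominator-supported k zero    = one-supported k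
  denominator-supported k (suc N) = ⊛-supported (denominator-supported k N) (⊛-supported g-supp (⊛-supported g-supp g-supp))
    where
    g-supp : SupportedOnMultiplesOf k (geom (k ℕ.* suc N))
    g-supp = geom-supported k (suc N)

  poch³-stable : ∀ i M → i ℕ.≤ M → (poch M ⊛ (poch M ⊛ poch M)) i ≡ (poch i ⊛ (poch i ⊛ poch i)) i
  poch³-stable i M i≤M = ⊛-cong-≈[≤] e (⊛-cong-≈[≤] e e) i ℕ.≤-refl
    where
    e : poch M ≈[≤ i ] poch i
    e = poch-stable i M i≤M

open import Data.Nat using (_+_; _*_; _^_; _<_)
open import Data.Nat.Divisibility using (divides; _∣?_)
open import Data.Integer using (ℤ; +_; _-_; ∣_∣) renaming (_+_ to _+ℤ_; _*_ to _*ℤ_)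
import Data.Integer.Properties as ℤ
open import Data.Integer.Divisibility using (_∣_)
import Data.Integer.Tactic.RingSolver as ℤ-Solver
open import Data.Nat.Tactic.RingSolver using (solve-∀)
open import Relation.Nullary using (¬_; yes; no)
open PowerSeries using (_⊛_; ⊛≗⊗; sumTo-zero; poch)
open BorweinProduct
open JacobiCoefficients using (poch³-coeff-nontriangular)

triangular-residue : ∀ k h n j d → C₂ (suc j) + d * k ≡ k * n + h → + k ∣ + ((2 * j + 1) ^ 2) - + (1 + 8 * h)
triangular-residue k h n j d T+dk≡kn+h =
  divides ∣ Y ∣ (≡.trans (≡.cong ∣_∣ difference) (≡.trans (ℤ.abs-* (+ k) Y) (ℕ.*-comm k ∣ Y ∣)))
  where
  open ≡.≡-Reasoning
  Y : ℤ
  Y = + (8 * n) - + (8 * d)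

  balance : (2 * j + 1) ^ 2 + k * (8 * d) ≡ k * (8 * n) + (1 + 8 * h)
  balance = begin
    (2 * j + 1) ^ 2 + k * (8 * d)     ≡⟨ ≡.cong (_+ k * (8 * d)) (JacobiExponents.odd² j) ⟩
    8 * C₂ (suc j) + 1 + k * (8 * d)  ≡⟨ distribute (C₂ (suc j)) d k ⟩
    8 * (C₂ (suc j) + d * k) + 1      ≡⟨ ≡.cong (λ m → 8 * m + 1) T+dk≡kn+h ⟩
    8 * (k * n + h) + 1               ≡⟨ collect k n h ⟩
    k * (8 * n) + (1 + 8 * h)         ∎
    where
    distribute : ∀ t d k → 8 * t + 1 + k * (8 * d) ≡ 8 * (t + d * k) + 1
    distribute = solve-∀
    collect : ∀ k n h → 8 * (k * n + h) + 1 ≡ k * (8 * n) + (1 + 8 * h)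
    collect = solve-∀

  difference : + ((2 * j + 1) ^ 2) - + (1 + 8 * h) ≡ + k *ℤ Y
  difference = begin
    + A - + B                            ≡⟨ add-both (+ A) (+ B) (+ E) ⟩
    (+ A +ℤ + E) - (+ B +ℤ + E)          ≡⟨ ≡.cong (_- (+ B +ℤ + E)) (≡.sym (ℤ.pos-+ A E)) ⟩
    + (A + E) - (+ B +ℤ + E)             ≡⟨ ≡.cong (λ z → + z - (+ B +ℤ + E)) balance ⟩
    + (C + B) - (+ B +ℤ + E)             ≡⟨ ≡.cong (_- (+ B +ℤ + E)) (ℤ.pos-+ C B) ⟩
    (+ C +ℤ + B) - (+ B +ℤ + E)          ≡⟨ cancel (+ C) (+ B) (+ E) ⟩
    + C - + E                            ≡⟨ ≡.cong₂ _-_ (ℤ.pos-* k (8 * n)) (ℤ.pos-* k (8 * d)) ⟩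
    + k *ℤ + (8 * n) - + k *ℤ + (8 * d)  ≡⟨ factor (+ k) (+ (8 * n)) (+ (8 * d)) ⟩
    + k *ℤ Y                             ∎
    where
    A B C E : ℕ
    A = (2 * j + 1) ^ 2
    B = 1 + 8 * h
    C = k * (8 * n)
    E = k * (8 * d)
    add-both : ∀ a b e → a - b ≡ (a +ℤ e) - (b +ℤ e)
    add-both = ℤ-Solver.solve-∀
    cancel : ∀ c b e → (c +ℤ b) - (b +ℤ e) ≡ c - e
    cancel = ℤ-Solver.solve-∀
    factor : ∀ k a b → k *ℤ a - k *ℤ b ≡ k *ℤ (a - b)
    factor = ℤ-Solver.solve-∀

corollary4p4 : (k h : ℕ) → (∃ λ m → k ≡ 1 + 2 * m) → h < k →
    (∀ (ℓ : ℕ) → ¬ ((+ k) ∣ (+ ((2 * ℓ + 1) ^ 2) - + (1 + 8 * h)))) →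
    ∀ (n : ℕ) → c3 k (k * n + h) ≡ + 0
corollary4p4 k h _ _ no-root n = begin
  c3 k m                                             ≡⟨ partialProd-factor k m m ⟩
  (P³ m ⊛ denominator k m) m                         ≡⟨ ⊛≗⊗ (P³ m) (denominator k m) m ⟩
  sumTo m (λ i → P³ m i *ℤ denominator k m (m ∸ i))  ≡⟨ sumTo-zero m vanishing ⟩
  + 0                                                ∎
  where
  open ≡.≡-Reasoning
  m : ℕ
  m = k * n + h
  P³ : ℕ → Series
  P³ M = poch M ⊛ (poch M ⊛ poch M)

  vanishing : ∀ i → i ℕ.≤ m → P³ m i *ℤ denominator k m (m ∸ i) ≡ + 0
  vanishing i i≤m with k ∣? (m ∸ i)
  ... | no  k∤m∸i = ≡.trans (≡.cong (P³ m i *ℤ_) (denominator-supported k m (m ∸ i) k∤m∸i)) (ℤ.*-zeroʳ (P³ m i))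
  ... | yes (divides d m∸i≡dk) =
    ≡.cong (_*ℤ denominator k m (m ∸ i)) (≡.trans (poch³-stable i m i≤m) (poch³-coeff-nontriangular i non-triangular))
    where
    non-triangular : ∀ j → C₂ (suc j) ≢ i
    non-triangular j T≡i = no-root j (triangular-residue k h n j d
      (≡.trans (≡.cong (_+ d * k) T≡i) (≡.trans (≡.cong (λ r → i + r) (≡.sym m∸i≡dk)) (ℕ.m+[n∸m]≡n i≤m))))
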